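{- Let $G,G'$ be games over a poset $A$ that are both in canonical form. If $G\equiv G'$, then $G=G'$ (they are literally the same game).
   Context: Games over a poset $A$: $[a]$ atomic for $a\in A$; $\{L\mid R\}$ composite for non-empty sets $L,R$ of games (left and right options); atomic games have no options; two games are equal iff both atomic with equal atoms, or both composite with equal sets of left options and equal sets of right options. $G\le H$ iff (1) every $G^L\triangleright H$, (2) every right option $H^R$ of $H$ has $G\triangleright H^R$, (3) if $G$ or $H$ atomic then $G\triangleright H$; $G\triangleright H$ iff (1) some $G^R\le H$, or (2) some left option $H^L$ of $H$ with $G\le H^L$, or (3) $G=[a],H=[b]$ atomic, $a\le b$. $G\equiv H$ iff $G\le H$ and $H\le G$. For distinct left options $H,K$ of $G$, $K$ is dominated if $K\le H$; for distinct right options, $K$ is dominated if $H\le K$. A left option $H$ of $G$ is reversible if $H$ has a right option $K$ with $K\le G$; a right option $H$ of $G$ is reversible if $H$ has a left option $K$ with $G\le K$. An option $H$ of $G$ is a passing option if $H\equiv G$. $G$ is in canonical form if it has no dominated, reversible, or passing options and all its options are in canonical form. -}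

module Defs where

open import Level using (0ℓ)
open import Relation.Binary.Bundles using (Poset)
open import Data.Product using (_×_; ∃; _,_)
open import Data.Sum using (_⊎_)
open import Data.Empty using (⊥)
open import Data.Unit using (⊤)
open import Relation.Nullary using (¬_)

module Games (P : Poset 0ℓ 0ℓ 0ℓ) where
  open Poset P renaming (Carrier to A; _≈_ to _≈ₐ_; _≤_ to _≤ₐ_)

  -- [a] atomic, or {L | R} with non-empty families of left/right options
  -- (non-emptiness witnessed by an index i : I, j : J).
  data Game : Set₁ where
    atom : A → Game
    comp : (I : Set) → I → (I → Game) → (J : Set) → J → (J → Game) → Game

  LIdx : Game → Set
  LIdx (atom _) = ⊥
  LIdx (comp I _ _ _ _ _) = I

  lOpt : (G : Game) → LIdx G → Game
  lOpt (comp _ _ L _ _ _) x = L x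

  RIdx : Game → Set
  RIdx (atom _) = ⊥
  RIdx (comp _ _ _ J _ _) = J

  rOpt : (G : Game) → RIdx G → Game
  rOpt (comp _ _ _ _ _ R) y = R y

  -- Literal equality of games: both atomic with equal atoms, or both
  -- composite with equal SETS of left options and equal SETS of right options.
  infix 4 _≐_
  _≐_ : Game → Game → Set
  atom a ≐ atom b = a ≈ₐ b
  atom _ ≐ comp _ _ _ _ _ _ = ⊥
  comp _ _ _ _ _ _ ≐ atom _ = ⊥
  comp I _ L J _ R ≐ comp I' _ L' J' _ R' =
    ((x : I) → ∃ λ (x' : I') → L x ≐ L' x') ×
    ((x' : I') → ∃ λ (x : I) → L x ≐ L' x') ×
    ((y : J) → ∃ λ (y' : J') → R y ≐ R' y') ×
    ((y' : J') → ∃ λ (y : J) → R y ≐ R' y')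

  infix 4 _≤ᵍ_ _▷_
  _≤ᵍ_ : Game → Game → Set
  _▷_  : Game → Game → Set

  atom a ≤ᵍ atom b = atom a ▷ atom b
  g@(atom a) ≤ᵍ h@(comp _ _ _ _ _ R) = ((y : _) → g ▷ R y) × (g ▷ h)
  g@(comp _ _ L _ _ _) ≤ᵍ h@(atom b) = ((x : _) → L x ▷ h) × (g ▷ h)
  g@(comp _ _ L _ _ _) ≤ᵍ h@(comp _ _ _ _ _ R) = ((x : _) → L x ▷ h) × ((y : _) → g ▷ R y)

  atom a ▷ atom b = a ≤ₐ b
  g@(atom a) ▷ comp _ _ L _ _ _ = ∃ λ x → g ≤ᵍ L x
  comp _ _ _ _ _ R ▷ h@(atom b) = ∃ λ y → R y ≤ᵍ h
  g@(comp _ _ _ _ _ R) ▷ h@(comp _ _ L _ _ _) =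
    (∃ λ y → R y ≤ᵍ h) ⊎ (∃ λ x → g ≤ᵍ L x)

  infix 4 _≡ᵍ_
  _≡ᵍ_ : Game → Game → Set
  G ≡ᵍ H = (G ≤ᵍ H) × (H ≤ᵍ G)

  -- Canonical form: no dominated, reversible or passing options, and all
  -- options canonical.  "Distinct" options = not literally equal.
  Canonical : Game → Set
  Canonical (atom _) = ⊤
  Canonical g@(comp I _ L J _ R) =
    -- no dominated left options: for distinct L x (=K), L x' (=H), not K ≤ H
    ((x x' : I) → ¬ (L x ≐ L x') → ¬ (L x ≤ᵍ L x')) ×
    -- no dominated right options: for distinct R y (=K), R y' (=H), not H ≤ K
    ((y y' : J) → ¬ (R y ≐ R y') → ¬ (R y' ≤ᵍ R y)) ×
    ((x : I) → ¬ (∃ λ (k : RIdx (L x)) → rOpt (L x) k ≤ᵍ g)) ×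
    ((y : J) → ¬ (∃ λ (k : LIdx (R y)) → g ≤ᵍ lOpt (R y) k)) ×
    ((x : I) → ¬ (L x ≡ᵍ g)) ×
    ((y : J) → ¬ (R y ≡ᵍ g)) ×
    ((x : I) → Canonical (L x)) ×
    ((y : J) → Canonical (R y))

-- Transitivity of ≤ᵍ (through the mutually defined ▷) lets an equivalence G ≡ᵍ G'
-- be pushed down to the options.  A left option Gᴸ of G satisfies Gᴸ ▷ G'; as Gᴸ is
-- not reversible this means Gᴸ ≤ᵍ G'ᴸ' for some left option of G', and symmetrically
-- G'ᴸ' ≤ᵍ Gᴸ''.  Then Gᴸ ≤ᵍ Gᴸ'', so non-domination forces Gᴸ ≐ Gᴸ'' and hence
-- Gᴸ ≡ᵍ G'ᴸ'.  Likewise for right options, and induction on the options finishes.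
-- An atom is never equivalent to a canonical composite game: the left option it
-- lies below would be passing or reversible.
module Submission where

open import Defs
open import Level using (0ℓ)
open import Relation.Binary.Bundles using (Poset)
open import Axiom.ExcludedMiddle using (ExcludedMiddle)
open import Data.Product using (∃; _,_; swap)
open import Data.Sum using (_⊎_; inj₁; inj₂)
open import Data.Empty using (⊥; ⊥-elim)
open import Relation.Nullary using (¬_; yes; no)

module CanonicalForm (P : Poset 0ℓ 0ℓ 0ℓ) where
  open Games P
  open Poset P using (module Eq) renaming (trans to ≤ₐ-trans; reflexive to ≤ₐ-reflexive; antisym to ≤ₐ-antisym)

  ▷-lOpt : ∀ G H (x : LIdx H) → G ≤ᵍ lOpt H x → G ▷ H
  ▷-lOpt (atom _)           (comp _ _ _ _ _ _) x p = x , p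
  ▷-lOpt (comp _ _ _ _ _ _) (comp _ _ _ _ _ _) x p = inj₂ (x , p)

  ▷-rOpt : ∀ G H (y : RIdx G) → rOpt G y ≤ᵍ H → G ▷ H
  ▷-rOpt (comp _ _ _ _ _ _) (atom _)           y p = y , p
  ▷-rOpt (comp _ _ _ _ _ _) (comp _ _ _ _ _ _) y p = inj₁ (y , p)

  ≤ᵍ⇒lOpt▷ : ∀ G H → G ≤ᵍ H → (x : LIdx G) → lOpt G x ▷ H
  ≤ᵍ⇒lOpt▷ (comp _ _ _ _ _ _) (atom _)           (f , _) = f
  ≤ᵍ⇒lOpt▷ (comp _ _ _ _ _ _) (comp _ _ _ _ _ _) (f , _) = f

  ≤ᵍ⇒▷rOpt : ∀ G H → G ≤ᵍ H → (y : RIdx H) → G ▷ rOpt H y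
  ≤ᵍ⇒▷rOpt (atom _)           (comp _ _ _ _ _ _) (f , _) = f
  ≤ᵍ⇒▷rOpt (comp _ _ _ _ _ _) (comp _ _ _ _ _ _) (_ , f) = f

  atom≤ᵍ⇒▷ : ∀ {a} H → atom a ≤ᵍ H → atom a ▷ H
  atom≤ᵍ⇒▷ (atom _)           p       = p
  atom≤ᵍ⇒▷ (comp _ _ _ _ _ _) (_ , p) = p

  ≤ᵍatom⇒▷ : ∀ {b} G → G ≤ᵍ atom b → G ▷ atom b
  ≤ᵍatom⇒▷ (atom _)           p       = p
  ≤ᵍatom⇒▷ (comp _ _ _ _ _ _) (_ , p) = p

  ▷comp-cases : ∀ {I i L J j R} X → X ▷ comp I i L J j R →
                (∃ λ k → rOpt X k ≤ᵍ comp I i L J j R) ⊎ (∃ λ x → X ≤ᵍ L x)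
  ▷comp-cases (atom _)           p = inj₂ p
  ▷comp-cases (comp _ _ _ _ _ _) p = p

  comp▷-cases : ∀ {I i L J j R} Y → comp I i L J j R ▷ Y →
                (∃ λ y → R y ≤ᵍ Y) ⊎ (∃ λ k → comp I i L J j R ≤ᵍ lOpt Y k)
  comp▷-cases (atom _)           p = inj₁ p
  comp▷-cases (comp _ _ _ _ _ _) p = p

  ≤ᵍ-trans   : ∀ G H K → G ≤ᵍ H → H ≤ᵍ K → G ≤ᵍ K
  ▷-≤ᵍ-trans : ∀ G H K → G ▷ H → H ≤ᵍ K → G ▷ K
  ≤ᵍ-▷-trans : ∀ G H K → G ≤ᵍ H → H ▷ K → G ▷ K

  ≤ᵍ-trans G@(atom _) H K@(atom _) p q = ≤ᵍ-▷-trans G H K p (≤ᵍatom⇒▷ H q)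
  ≤ᵍ-trans G@(atom _) H K@(comp _ _ _ _ _ RK) p q =
    (λ y → ≤ᵍ-▷-trans G H (RK y) p (≤ᵍ⇒▷rOpt H K q y)) , ▷-≤ᵍ-trans G H K (atom≤ᵍ⇒▷ H p) q
  ≤ᵍ-trans G@(comp _ _ LG _ _ _) H K@(atom _) p q =
    (λ x → ▷-≤ᵍ-trans (LG x) H K (≤ᵍ⇒lOpt▷ G H p x) q) , ≤ᵍ-▷-trans G H K p (≤ᵍatom⇒▷ H q)
  ≤ᵍ-trans G@(comp _ _ LG _ _ _) H K@(comp _ _ _ _ _ RK) p q =
    (λ x → ▷-≤ᵍ-trans (LG x) H K (≤ᵍ⇒lOpt▷ G H p x) q) , (λ y → ≤ᵍ-▷-trans G H (RK y) p (≤ᵍ⇒▷rOpt H K q y))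

  ▷-≤ᵍ-trans (atom _) (atom _) (atom _) p q = ≤ₐ-trans p q
  ▷-≤ᵍ-trans (atom a) (atom b) K@(comp _ _ LK _ _ _) p (_ , x , q) =
    ▷-lOpt (atom a) K x (≤ᵍ-trans (atom a) (atom b) (LK x) p q)
  ▷-≤ᵍ-trans (atom a) H@(comp _ _ LH _ _ _) K (x , p) q = ≤ᵍ-▷-trans (atom a) (LH x) K p (≤ᵍ⇒lOpt▷ H K q x)
  ▷-≤ᵍ-trans G@(comp _ _ _ _ _ RG) (atom b) K (y , p) q = ▷-rOpt G K y (≤ᵍ-trans (RG y) (atom b) K p q)
  ▷-≤ᵍ-trans G@(comp _ _ _ _ _ RG) H@(comp _ _ _ _ _ _) K (inj₁ (y , p)) q =
    ▷-rOpt G K y (≤ᵍ-trans (RG y) H K p q)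
  ▷-≤ᵍ-trans G@(comp _ _ _ _ _ _) H@(comp _ _ LH _ _ _) K (inj₂ (x , p)) q =
    ≤ᵍ-▷-trans G (LH x) K p (≤ᵍ⇒lOpt▷ H K q x)

  ≤ᵍ-▷-trans G (atom b) (atom c) p q = ▷-≤ᵍ-trans G (atom b) (atom c) (≤ᵍatom⇒▷ G p) q
  ≤ᵍ-▷-trans G (atom b) K@(comp _ _ LK _ _ _) p (x , q) = ▷-lOpt G K x (≤ᵍ-trans G (atom b) (LK x) p q)
  ≤ᵍ-▷-trans G H@(comp _ _ _ _ _ RH) (atom c) p (y , q) = ▷-≤ᵍ-trans G (RH y) (atom c) (≤ᵍ⇒▷rOpt G H p y) q
  ≤ᵍ-▷-trans G H@(comp _ _ _ _ _ RH) K@(comp _ _ _ _ _ _) p (inj₁ (y , q)) =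
    ▷-≤ᵍ-trans G (RH y) K (≤ᵍ⇒▷rOpt G H p y) q
  ≤ᵍ-▷-trans G H@(comp _ _ _ _ _ _) K@(comp _ _ LK _ _ _) p (inj₂ (x , q)) =
    ▷-lOpt G K x (≤ᵍ-trans G H (LK x) p q)

  ≐-sym : ∀ G H → G ≐ H → H ≐ G
  ≐-sym (atom _) (atom _) e = Eq.sym e
  ≐-sym (comp _ _ L _ _ R) (comp _ _ L' _ _ R') (l , l' , r , r') =
    (λ x' → let (x , e) = l' x' in x , ≐-sym (L x) (L' x') e) ,
    (λ x → let (x' , e) = l x in x' , ≐-sym (L x) (L' x') e) ,
    (λ y' → let (y , e) = r' y' in y , ≐-sym (R y) (R' y') e) ,
    (λ y → let (y' , e) = r y in y' , ≐-sym (R y) (R' y') e)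

  ≐⇒≤ᵍ : ∀ G H → G ≐ H → G ≤ᵍ H
  ≐⇒≤ᵍ (atom _) (atom _) e = ≤ₐ-reflexive e
  ≐⇒≤ᵍ G@(comp _ _ L _ _ R) H@(comp _ _ L' _ _ R') (l , _ , _ , r') =
    (λ x → let (x' , e) = l x in ▷-lOpt (L x) H x' (≐⇒≤ᵍ (L x) (L' x') e)) ,
    (λ y' → let (y , e) = r' y' in ▷-rOpt G (R' y') y (≐⇒≤ᵍ (R y) (R' y') e))

  ¬atom≡ᵍcanonical : ∀ {a I i L J j R} → Canonical (comp I i L J j R) → ¬ (atom a ≡ᵍ comp I i L J j R)
  ¬atom≡ᵍcanonical {a} {I} {i} {L} {J} {j} {R} (_ , _ , revL , _ , passL , _) (G≥a@(_ , x , a≤Lx) , G≤a) =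
    passing-or-reversible (L x) a≤Lx (≤ᵍ⇒lOpt▷ G (atom a) G≤a x) (passL x) (revL x)
    where
    G = comp I i L J j R
    passing-or-reversible : ∀ K → atom a ≤ᵍ K → K ▷ atom a →
                       ¬ (K ≡ᵍ G) → ¬ (∃ λ k → rOpt K k ≤ᵍ G) → ⊥
    passing-or-reversible K@(atom _) a≤K K≤a passing _ =
      passing (≤ᵍ-trans K (atom a) G K≤a G≥a , ≤ᵍ-trans G (atom a) K G≤a a≤K)
    passing-or-reversible (comp _ _ _ _ _ RK) _ (k , RKk≤a) _ reversible =
      reversible (k , ≤ᵍ-trans (RK k) (atom a) G RKk≤a G≥a)

  module _ (em : ExcludedMiddle 0ℓ) where

    canonical-left-match : ∀ G G' → Canonical G → Canonical G' → G ≡ᵍ G' →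
                           (x : LIdx G) → ∃ λ x' → lOpt G x ≡ᵍ lOpt G' x'
    canonical-left-match G@(comp _ _ _ _ _ _) (atom _) cG _ e _ = ⊥-elim (¬atom≡ᵍcanonical cG (swap e))
    canonical-left-match G@(comp _ _ L _ _ _) G'@(comp _ _ L' _ _ _)
                         (domL , _ , revL , _) (_ , _ , revL' , _) (G≤G' , G'≤G) x
      with ▷comp-cases (L x) (≤ᵍ⇒lOpt▷ G G' G≤G' x)
    ... | inj₁ (k , Lxᴿ≤G') = ⊥-elim (revL x (k , ≤ᵍ-trans (rOpt (L x) k) G' G Lxᴿ≤G' G'≤G))
    ... | inj₂ (x' , Lx≤L'x') with ▷comp-cases (L' x') (≤ᵍ⇒lOpt▷ G' G G'≤G x')
    ...   | inj₁ (k , L'x'ᴿ≤G) = ⊥-elim (revL' x' (k , ≤ᵍ-trans (rOpt (L' x') k) G G' L'x'ᴿ≤G G≤G'))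
    ...   | inj₂ (x'' , L'x'≤Lx'') with em {L x ≐ L x''}
    ...     | yes e = x' , Lx≤L'x' , ≤ᵍ-trans (L' x') (L x'') (L x) L'x'≤Lx'' (≐⇒≤ᵍ (L x'') (L x) (≐-sym (L x) (L x'') e))
    ...     | no ne = ⊥-elim (domL x x'' ne (≤ᵍ-trans (L x) (L' x') (L x'') Lx≤L'x' L'x'≤Lx''))

    canonical-right-match : ∀ G G' → Canonical G → Canonical G' → G ≡ᵍ G' →
                            (y : RIdx G) → ∃ λ y' → rOpt G y ≡ᵍ rOpt G' y'
    canonical-right-match G@(comp _ _ _ _ _ _) (atom _) cG _ e _ = ⊥-elim (¬atom≡ᵍcanonical cG (swap e))
    canonical-right-match G@(comp _ _ _ _ _ R) G'@(comp _ _ _ _ _ R')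
                          (_ , domR , _ , revR , _) (_ , _ , _ , revR' , _) (G≤G' , G'≤G) y
      with comp▷-cases (R y) (≤ᵍ⇒▷rOpt G' G G'≤G y)
    ... | inj₂ (k , G≤Ryᴸ) = ⊥-elim (revR y (k , ≤ᵍ-trans G G' (lOpt (R y) k) G≤G' G≤Ryᴸ))
    ... | inj₁ (y' , R'y'≤Ry) with comp▷-cases (R' y') (≤ᵍ⇒▷rOpt G G' G≤G' y')
    ...   | inj₂ (k , G'≤R'y'ᴸ) = ⊥-elim (revR' y' (k , ≤ᵍ-trans G' G (lOpt (R' y') k) G'≤G G'≤R'y'ᴸ))
    ...   | inj₁ (y'' , Ry''≤R'y') with em {R y ≐ R y''}
    ...     | yes e = y' , ≤ᵍ-trans (R y) (R y'') (R' y') (≐⇒≤ᵍ (R y) (R y'') e) Ry''≤R'y' , R'y'≤Ry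
    ...     | no ne = ⊥-elim (domR y y'' ne (≤ᵍ-trans (R y'') (R' y') (R y) Ry''≤R'y' R'y'≤Ry))

    canonical-≡ᵍ⇒≐ : ∀ G G' → Canonical G → Canonical G' → G ≡ᵍ G' → G ≐ G'
    canonical-≡ᵍ⇒≐ (atom _) (atom _) _ _ (p , q) = ≤ₐ-antisym p q
    canonical-≡ᵍ⇒≐ (atom _) (comp _ _ _ _ _ _) _ cG' e = ⊥-elim (¬atom≡ᵍcanonical cG' e)
    canonical-≡ᵍ⇒≐ (comp _ _ _ _ _ _) (atom _) cG _ e = ⊥-elim (¬atom≡ᵍcanonical cG (swap e))
    canonical-≡ᵍ⇒≐ G@(comp _ _ L _ _ R) G'@(comp _ _ L' _ _ R')
                   cG@(_ , _ , _ , _ , _ , _ , canL , canR) cG'@(_ , _ , _ , _ , _ , _ , canL' , canR') e =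
      (λ x → let (x' , e') = canonical-left-match G G' cG cG' e x
             in x' , canonical-≡ᵍ⇒≐ (L x) (L' x') (canL x) (canL' x') e') ,
      (λ x' → let (x , e') = canonical-left-match G' G cG' cG (swap e) x'
              in x , canonical-≡ᵍ⇒≐ (L x) (L' x') (canL x) (canL' x') (swap e')) ,
      (λ y → let (y' , e') = canonical-right-match G G' cG cG' e y
             in y' , canonical-≡ᵍ⇒≐ (R y) (R' y') (canR y) (canR' y') e') ,
      (λ y' → let (y , e') = canonical-right-match G' G cG' cG (swap e) y'
              in y , canonical-≡ᵍ⇒≐ (R y) (R' y') (canR y) (canR' y') (swap e'))

lemma4p21 : ExcludedMiddle 0ℓ → (P : Poset 0ℓ 0ℓ 0ℓ) → (G G' : Games.Game P)
          → Games.Canonical P G → Games.Canonical P G'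
          → Games._≡ᵍ_ P G G' → Games._≐_ P G G'
lemma4p21 em P = CanonicalForm.canonical-≡ᵍ⇒≐ P em
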